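{- $f_3(5,3)=\dfrac{15}{8}=\rho_3(\mathrm{BT}(2))$, where $\mathrm{BT}(2)=C_5\vee I_3$.
   Context: All graphs are finite and simple. For integers $\Delta,\omega$, let $\mathcal{G}(\Delta,\omega)$ be the class of graphs $G$ with maximum degree $\Delta(G)\le\Delta$ and clique number $\omega(G)\le\omega$. For a graph $G$, $k_t(G)$ denotes the number of copies of $K_t$ in $G$, and $\rho_t(G)=k_t(G)/|V(G)|$. For a positive integer $n$ let $k_t(n,\Delta,\omega)=\max\{k_t(G): |V(G)|=n,\ G\in\mathcal{G}(\Delta,\omega)\}$, and define $f_t(\Delta,\omega)=\lim_{n\to\infty}k_t(n,\Delta,\omega)/n$ (this limit exists and equals $\sup_{n}k_t(n,\Delta,\omega)/n$). $C_5\vee I_3$ is the join of the 5-cycle with an independent set of 3 vertices (each of the 3 vertices adjacent to all vertices of the $C_5$); it has 8 vertices. -}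

module Defs where

open import Data.Nat using (ℕ; zero; suc; _+_; _*_; _≤_; _<ᵇ_; _≡ᵇ_; _%_)
open import Data.Bool using (Bool; true; false; _∧_; _∨_; not; if_then_else_)
open import Data.Fin using (Fin; zero; suc; toℕ)
open import Data.List using (List; length; allFin; map)
open import Data.Nat.ListAction using (sum)
open import Data.List.Relation.Unary.Unique.Propositional using (Unique)
open import Data.List.Relation.Unary.AllPairs using (AllPairs)
open import Data.Product using (_×_)
open import Relation.Binary.PropositionalEquality using (_≡_; refl)

record Graph (n : ℕ) : Set where
  field
    adj    : Fin n → Fin n → Bool
    sym    : ∀ i j → adj i j ≡ adj j i
    irrefl : ∀ i → adj i i ≡ false
open Graph public

count : {n : ℕ} → (Fin n → Bool) → ℕ
count {n} p = sum (map (λ i → if p i then 1 else 0) (allFin n))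

degree : {n : ℕ} → Graph n → Fin n → ℕ
degree G i = count (adj G i)

MaxDegreeAtMost : {n : ℕ} → Graph n → ℕ → Set
MaxDegreeAtMost G Δ = ∀ i → degree G i ≤ Δ

IsClique : {n : ℕ} → Graph n → List (Fin n) → Set
IsClique G S = Unique S × AllPairs (λ x y → adj G x y ≡ true) S

CliqueNumberAtMost : {n : ℕ} → Graph n → ℕ → Set
CliqueNumberAtMost {n} G ω = (S : List (Fin n)) → IsClique G S → length S ≤ ω

InClass : {n : ℕ} → Graph n → ℕ → ℕ → Set
InClass G Δ ω = MaxDegreeAtMost G Δ × CliqueNumberAtMost G ω

sumFin : {n : ℕ} → (Fin n → ℕ) → ℕ
sumFin {n} f = sum (map f (allFin n))

k₃ : {n : ℕ} → Graph n → ℕ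
k₃ G = sumFin λ i → sumFin λ j → sumFin λ k →
  if (toℕ i <ᵇ toℕ j) ∧ (toℕ j <ᵇ toℕ k) ∧ adj G i j ∧ adj G j k ∧ adj G i k
  then 1 else 0

-- BT(2) = C₅ ∨ I₃ on vertex set Fin 8: vertices 0..4 form the 5-cycle
-- 0-1-2-3-4-0, vertices 5,6,7 are independent and adjacent to all of 0..4.
bt2-adjℕ : ℕ → ℕ → Bool
bt2-adjℕ a b =
  if (a <ᵇ 5) ∧ (b <ᵇ 5)
  then (((a + 1) % 5) ≡ᵇ b) ∨ (((b + 1) % 5) ≡ᵇ a)
  else ((a <ᵇ 5) ∨ (b <ᵇ 5))

bt2-adj : Fin 8 → Fin 8 → Bool
bt2-adj i j = bt2-adjℕ (toℕ i) (toℕ j)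

bt2-sym : ∀ i j → bt2-adj i j ≡ bt2-adj j i
bt2-sym zero zero = refl
bt2-sym zero (suc zero) = refl
bt2-sym zero (suc (suc zero)) = refl
bt2-sym zero (suc (suc (suc zero))) = refl
bt2-sym zero (suc (suc (suc (suc zero)))) = refl
bt2-sym zero (suc (suc (suc (suc (suc zero))))) = refl
bt2-sym zero (suc (suc (suc (suc (suc (suc zero)))))) = refl
bt2-sym zero (suc (suc (suc (suc (suc (suc (suc zero))))))) = refl
bt2-sym (suc zero) zero = refl
bt2-sym (suc zero) (suc zero) = refl
bt2-sym (suc zero) (suc (suc zero)) = refl
bt2-sym (suc zero) (suc (suc (suc zero))) = refl
bt2-sym (suc zero) (suc (suc (suc (suc zero)))) = refl
bt2-sym (suc zero) (suc (suc (suc (suc (suc zero))))) = refl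
bt2-sym (suc zero) (suc (suc (suc (suc (suc (suc zero)))))) = refl
bt2-sym (suc zero) (suc (suc (suc (suc (suc (suc (suc zero))))))) = refl
bt2-sym (suc (suc zero)) zero = refl
bt2-sym (suc (suc zero)) (suc zero) = refl
bt2-sym (suc (suc zero)) (suc (suc zero)) = refl
bt2-sym (suc (suc zero)) (suc (suc (suc zero))) = refl
bt2-sym (suc (suc zero)) (suc (suc (suc (suc zero)))) = refl
bt2-sym (suc (suc zero)) (suc (suc (suc (suc (suc zero))))) = refl
bt2-sym (suc (suc zero)) (suc (suc (suc (suc (suc (suc zero)))))) = refl
bt2-sym (suc (suc zero)) (suc (suc (suc (suc (suc (suc (suc zero))))))) = refl
bt2-sym (suc (suc (suc zero))) zero = refl
bt2-sym (suc (suc (suc zero))) (suc zero) = refl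
bt2-sym (suc (suc (suc zero))) (suc (suc zero)) = refl
bt2-sym (suc (suc (suc zero))) (suc (suc (suc zero))) = refl
bt2-sym (suc (suc (suc zero))) (suc (suc (suc (suc zero)))) = refl
bt2-sym (suc (suc (suc zero))) (suc (suc (suc (suc (suc zero))))) = refl
bt2-sym (suc (suc (suc zero))) (suc (suc (suc (suc (suc (suc zero)))))) = refl
bt2-sym (suc (suc (suc zero))) (suc (suc (suc (suc (suc (suc (suc zero))))))) = refl
bt2-sym (suc (suc (suc (suc zero)))) zero = refl
bt2-sym (suc (suc (suc (suc zero)))) (suc zero) = refl
bt2-sym (suc (suc (suc (suc zero)))) (suc (suc zero)) = refl
bt2-sym (suc (suc (suc (suc zero)))) (suc (suc (suc zero))) = refl
bt2-sym (suc (suc (suc (suc zero)))) (suc (suc (suc (suc zero)))) = refl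
bt2-sym (suc (suc (suc (suc zero)))) (suc (suc (suc (suc (suc zero))))) = refl
bt2-sym (suc (suc (suc (suc zero)))) (suc (suc (suc (suc (suc (suc zero)))))) = refl
bt2-sym (suc (suc (suc (suc zero)))) (suc (suc (suc (suc (suc (suc (suc zero))))))) = refl
bt2-sym (suc (suc (suc (suc (suc zero))))) zero = refl
bt2-sym (suc (suc (suc (suc (suc zero))))) (suc zero) = refl
bt2-sym (suc (suc (suc (suc (suc zero))))) (suc (suc zero)) = refl
bt2-sym (suc (suc (suc (suc (suc zero))))) (suc (suc (suc zero))) = refl
bt2-sym (suc (suc (suc (suc (suc zero))))) (suc (suc (suc (suc zero)))) = refl
bt2-sym (suc (suc (suc (suc (suc zero))))) (suc (suc (suc (suc (suc zero))))) = refl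
bt2-sym (suc (suc (suc (suc (suc zero))))) (suc (suc (suc (suc (suc (suc zero)))))) = refl
bt2-sym (suc (suc (suc (suc (suc zero))))) (suc (suc (suc (suc (suc (suc (suc zero))))))) = refl
bt2-sym (suc (suc (suc (suc (suc (suc zero)))))) zero = refl
bt2-sym (suc (suc (suc (suc (suc (suc zero)))))) (suc zero) = refl
bt2-sym (suc (suc (suc (suc (suc (suc zero)))))) (suc (suc zero)) = refl
bt2-sym (suc (suc (suc (suc (suc (suc zero)))))) (suc (suc (suc zero))) = refl
bt2-sym (suc (suc (suc (suc (suc (suc zero)))))) (suc (suc (suc (suc zero)))) = refl
bt2-sym (suc (suc (suc (suc (suc (suc zero)))))) (suc (suc (suc (suc (suc zero))))) = refl
bt2-sym (suc (suc (suc (suc (suc (suc zero)))))) (suc (suc (suc (suc (suc (suc zero)))))) = refl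
bt2-sym (suc (suc (suc (suc (suc (suc zero)))))) (suc (suc (suc (suc (suc (suc (suc zero))))))) = refl
bt2-sym (suc (suc (suc (suc (suc (suc (suc zero))))))) zero = refl
bt2-sym (suc (suc (suc (suc (suc (suc (suc zero))))))) (suc zero) = refl
bt2-sym (suc (suc (suc (suc (suc (suc (suc zero))))))) (suc (suc zero)) = refl
bt2-sym (suc (suc (suc (suc (suc (suc (suc zero))))))) (suc (suc (suc zero))) = refl
bt2-sym (suc (suc (suc (suc (suc (suc (suc zero))))))) (suc (suc (suc (suc zero)))) = refl
bt2-sym (suc (suc (suc (suc (suc (suc (suc zero))))))) (suc (suc (suc (suc (suc zero))))) = refl
bt2-sym (suc (suc (suc (suc (suc (suc (suc zero))))))) (suc (suc (suc (suc (suc (suc zero)))))) = refl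
bt2-sym (suc (suc (suc (suc (suc (suc (suc zero))))))) (suc (suc (suc (suc (suc (suc (suc zero))))))) = refl

bt2-irrefl : ∀ i → bt2-adj i i ≡ false
bt2-irrefl zero = refl
bt2-irrefl (suc zero) = refl
bt2-irrefl (suc (suc zero)) = refl
bt2-irrefl (suc (suc (suc zero))) = refl
bt2-irrefl (suc (suc (suc (suc zero)))) = refl
bt2-irrefl (suc (suc (suc (suc (suc zero))))) = refl
bt2-irrefl (suc (suc (suc (suc (suc (suc zero)))))) = refl
bt2-irrefl (suc (suc (suc (suc (suc (suc (suc zero))))))) = refl

BT2 : Graph 8
BT2 = record { adj = bt2-adj ; sym = bt2-sym ; irrefl = bt2-irrefl }

{-# OPTIONS --safe #-}
-- Let c(x) = codegreeSum G x, the number of ordered pairs of adjacent neighbours of x; it is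
-- twice the number of triangles through x, so Σₓ c(x) = 6 k₃. As ω ≤ 3 the neighbourhood of x is
-- triangle-free with at most Δ = 5 vertices, so c(x) ≤ 12, and c(x) ≥ 11 forces it to be K₂,₃
-- (both by exhaustion over the graphs on at most five vertices); call such x full. A full x has
-- three non-full neighbours: for y on the 3-side of its K₂,₃ and a neighbour a of y there, x and a
-- are adjacent neighbours of y having at most two common neighbours with y each (a has three
-- neighbours in N(x) outside N(y) and degree ≤ 5), whereas every edge of K₂,₃ has an endpoint of
-- degree 3. Every full vertex sends 2 to each non-full neighbour; afterwards every vertex satisfies
-- 8 c(x) + received ≤ 90 + sent (96 = 90 + 2·3 and 80 + 2·5 = 90), whence 48 k₃ ≤ 90 n.
-- C₅ ∨ I₃ attains the bound by direct computation.
module Submission where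

open import Defs hiding (sym)
open import Data.Nat using (ℕ; zero; suc; _+_; _*_; _≤_; _≤?_; _<ᵇ_; _≤ᵇ_; z≤n; s≤s)
open import Data.Nat.Properties
  using ( ≤-refl; ≤-trans; ≤-pred; ≰⇒>; <⇒≱; <-irrefl; <-trans; m≤m+n; m≤n⇒m<n∨m≡n
        ; <ᵇ⇒<; <⇒<ᵇ; ≤ᵇ⇒≤; +-mono-≤; +-monoˡ-≤; +-monoʳ-≤; *-mono-≤; *-monoʳ-≤
        ; +-cancelˡ-≤; +-cancelʳ-≤; *-cancelˡ-≤; *-assoc; *-comm; *-identityˡ; *-identityʳ; +-identityʳ
        ; module ≤-Reasoning )
open import Data.Nat.Solver using (module +-*-Solver)
open import Data.Bool using (Bool; true; false; _∧_; not; if_then_else_; T)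
open import Data.Bool.Properties using (T-∧; T-≡; ∧-comm; ∧-assoc; ∧-zeroʳ) renaming (_≟_ to _≟ᵇ_)
open import Data.Fin using (Fin; zero; suc; toℕ)
open import Data.Fin.Properties using (all?; any?)
open import Data.List using (List; []; _∷_; map; allFin; tabulate; length; lookup; filterᵇ)
open import Data.List.Properties using (map-tabulate; map-cong)
open import Data.List.Membership.Propositional.Properties using (∈-filter⁺; ∈-filter⁻; ∈-lookup; ∈-allFin)
open import Data.List.Relation.Unary.All using ([]; _∷_)
open import Data.List.Relation.Unary.AllPairs using ([]; _∷_)
import Data.List.Relation.Unary.Any as Any
open import Data.List.Relation.Unary.Any.Properties using (lookup-index)
import Data.Nat.ListAction as List
open import Data.Vec.Functional as Vec using (Vector; tail)
open import Data.Product using (_×_; _,_; proj₁; proj₂; ∃-syntax)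
open import Data.Sum using (_⊎_; inj₁; inj₂; [_,_]′)
import Data.Sum as Sum
open import Data.Empty using (⊥-elim)
open import Function using (_∘_)
open import Function.Bundles using (Equivalence)
open import Relation.Nullary using (Dec; yes; no; does; isYes; ¬_; T?)
open import Relation.Nullary.Decidable using (toWitness; map′; _×-dec_; _⊎-dec_; _→-dec_)
open import Relation.Binary.PropositionalEquality
  using (_≡_; refl; sym; trans; cong; subst; _≗_; module ≡-Reasoning)
open import Algebra.Properties.Semiring.Sum Data.Nat.Properties.+-*-semiring
  using (sum-syntax; sum-cong-≗; ∑-comm; ∑-distrib-+; *-distribˡ-sum; sum-replicate-zero)

⟦_⟧ : Bool → ℕ
⟦ b ⟧ = if b then 1 else 0

⟦⟧≤1 : ∀ b → ⟦ b ⟧ ≤ 1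
⟦⟧≤1 true  = ≤-refl
⟦⟧≤1 false = z≤n

⟦∧⟧ : ∀ a b → ⟦ a ∧ b ⟧ ≡ (if a then ⟦ b ⟧ else 0)
⟦∧⟧ true  b = refl
⟦∧⟧ false b = refl

⟦∧⟧≡* : ∀ a b → ⟦ a ∧ b ⟧ ≡ ⟦ a ⟧ * ⟦ b ⟧
⟦∧⟧≡* true  b = sym (+-identityʳ ⟦ b ⟧)
⟦∧⟧≡* false b = refl

⟦x∧y∧z⟧≤⟦y⟧ : ∀ a b c → ⟦ a ∧ b ∧ c ⟧ ≤ ⟦ b ⟧
⟦x∧y∧z⟧≤⟦y⟧ true  true  c = ⟦⟧≤1 c
⟦x∧y∧z⟧≤⟦y⟧ true  false c = z≤n
⟦x∧y∧z⟧≤⟦y⟧ false b     c = z≤n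

⟦p∧q⟧+⟦p∧r⟧≤⟦p⟧ : ∀ p q r → (p ∧ q ∧ r) ≡ false → ⟦ p ∧ q ⟧ + ⟦ p ∧ r ⟧ ≤ ⟦ p ⟧
⟦p∧q⟧+⟦p∧r⟧≤⟦p⟧ true  true  true  ()
⟦p∧q⟧+⟦p∧r⟧≤⟦p⟧ true  true  false _ = ≤-refl
⟦p∧q⟧+⟦p∧r⟧≤⟦p⟧ true  false r     _ = ⟦⟧≤1 r
⟦p∧q⟧+⟦p∧r⟧≤⟦p⟧ false q     r     _ = ≤-refl

sum-tabulate : ∀ {n} (f : Fin n → ℕ) → List.sum (tabulate f) ≡ ∑[ i < n ] f i
sum-tabulate {zero}  f = refl
sum-tabulate {suc n} f = cong (f zero +_) (sum-tabulate (f ∘ suc))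

sumFin≡∑ : ∀ {n} (f : Fin n → ℕ) → sumFin f ≡ ∑[ i < n ] f i
sumFin≡∑ f = trans (cong List.sum (map-tabulate (λ i → i) f)) (sum-tabulate f)

∑-mono-≤ : ∀ {n} {f g : Fin n → ℕ} → (∀ i → f i ≤ g i) → ∑[ i < n ] f i ≤ ∑[ i < n ] g i
∑-mono-≤ {zero}  f≤g = z≤n
∑-mono-≤ {suc n} f≤g = +-mono-≤ (f≤g zero) (∑-mono-≤ (f≤g ∘ suc))

∑-const : ∀ n c → ∑[ i < n ] c ≡ n * c
∑-const zero    c = refl
∑-const (suc n) c = cong (c +_) (∑-const n c)

degree≡∑ : ∀ {n} (G : Graph n) i → degree G i ≡ ∑[ j < n ] ⟦ adj G i j ⟧
degree≡∑ G i = sumFin≡∑ (λ j → ⟦ adj G i j ⟧)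

degree-cong : ∀ {n} (G H : Graph n) → (∀ i j → adj G i j ≡ adj H i j) → ∀ i → degree G i ≡ degree H i
degree-cong G H G≗H i = cong List.sum (map-cong (λ j → cong ⟦_⟧ (G≗H i j)) (allFin _))

-- Exhaustive checks over all graphs on k vertices

-- bits v is v rebuilt from its entries; f (bits v) computes by the same clauses that
-- everyVector k f evaluated, which lets the check apply to every v without extensionality.
bits : ∀ {k} → Vector Bool k → Vector Bool k
bits {zero}  v = Vec.[]
bits {suc k} v = v zero Vec.∷ bits (tail v)

bits-correct : ∀ {k} (v : Vector Bool k) → bits v ≗ v
bits-correct v zero    = refl
bits-correct v (suc i) = bits-correct (tail v) i

everyVector : (k : ℕ) → (Vector Bool k → Bool) → Bool
everyVector zero    f = f Vec.[]
everyVector (suc k) f = everyVector k (λ v → f (true Vec.∷ v) ∧ f (false Vec.∷ v))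

everyVector-sound : ∀ {k} (f : Vector Bool k → Bool) → T (everyVector k f) → ∀ v → T (f (bits v))
everyVector-sound {zero}  f ok v = ok
everyVector-sound {suc k} f ok v = pick (v zero) (everyVector-sound _ ok (tail v))
  where
  pick : ∀ {w} b → T (f (true Vec.∷ w) ∧ f (false Vec.∷ w)) → T (f (b Vec.∷ w))
  pick true  = proj₁ ∘ Equivalence.to T-∧
  pick false = proj₂ ∘ Equivalence.to T-∧

emptyGraph : Graph 0
emptyGraph = record { adj = λ () ; sym = λ () ; irrefl = λ () }

extend : ∀ {k} → Graph k → Vector Bool k → Graph (suc k)
extend {k} H v = record { adj = adj′ ; sym = sym′ ; irrefl = irrefl′ }
  where
  adj′ : Fin (suc k) → Fin (suc k) → Bool
  adj′ zero    zero    = false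
  adj′ zero    (suc j) = v j
  adj′ (suc i) zero    = v i
  adj′ (suc i) (suc j) = adj H i j
  sym′ : ∀ i j → adj′ i j ≡ adj′ j i
  sym′ zero    zero    = refl
  sym′ zero    (suc j) = refl
  sym′ (suc i) zero    = refl
  sym′ (suc i) (suc j) = Graph.sym H i j
  irrefl′ : ∀ i → adj′ i i ≡ false
  irrefl′ zero    = refl
  irrefl′ (suc i) = irrefl H i

deleteZero : ∀ {k} → Graph (suc k) → Graph k
deleteZero H = record
  { adj    = λ i j → adj H (suc i) (suc j)
  ; sym    = λ i j → Graph.sym H (suc i) (suc j)
  ; irrefl = λ i → irrefl H (suc i)
  }

canonical : ∀ {k} → Graph k → Graph k
canonical {zero}  H = emptyGraph
canonical {suc k} H = extend (canonical (deleteZero H)) (bits (λ j → adj H zero (suc j)))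

canonical-adj : ∀ {k} (H : Graph k) i j → adj (canonical H) i j ≡ adj H i j
canonical-adj {suc k} H zero    zero    = sym (irrefl H zero)
canonical-adj {suc k} H zero    (suc j) = bits-correct _ j
canonical-adj {suc k} H (suc i) zero    = trans (bits-correct _ i) (Graph.sym H zero (suc i))
canonical-adj {suc k} H (suc i) (suc j) = canonical-adj (deleteZero H) i j

everyGraph : (k : ℕ) → (Graph k → Bool) → Bool
everyGraph zero    f = f emptyGraph
everyGraph (suc k) f = everyGraph k (λ H → everyVector k (f ∘ extend H))

everyGraph-sound : ∀ {k} (f : Graph k → Bool) → T (everyGraph k f) → ∀ H → T (f (canonical H))
everyGraph-sound {zero}  f ok H = ok
everyGraph-sound {suc k} f ok H =
  everyVector-sound (f ∘ extend (canonical (deleteZero H)))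
    (everyGraph-sound _ ok (deleteZero H)) (λ j → adj H zero (suc j))

byExhaustion : ∀ {k} {P : Graph k → Set} (P? : ∀ H → Dec (P H)) →
               T (everyGraph k (isYes ∘ P?)) → ∀ H → P (canonical H)
byExhaustion P? ok H = toWitness {a? = P? (canonical H)} (everyGraph-sound _ ok H)

-- Triangle-free graphs on at most five vertices

triangle : ∀ {n} → Graph n → Fin n → Fin n → Fin n → Bool
triangle G a b c = adj G a b ∧ adj G a c ∧ adj G b c

TriangleFree : ∀ {n} → Graph n → Set
TriangleFree {n} G = ∀ (a b c : Fin n) → triangle G a b c ≡ false

triangleFree? : ∀ {n} (G : Graph n) → Dec (TriangleFree G)
triangleFree? G = all? λ a → all? λ b → all? λ c → triangle G a b c ≟ᵇ false

degreeSum : ∀ {m} → Graph m → ℕ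
degreeSum {m} H = ∑[ s < m ] degree H s

module _ {k : ℕ} (H : Graph k) where

  canonical-triangleFree : TriangleFree H → TriangleFree (canonical H)
  canonical-triangleFree tf a b c
    rewrite canonical-adj H a b | canonical-adj H a c | canonical-adj H b c = tf a b c

  canonical-degree : ∀ s → degree (canonical H) s ≡ degree H s
  canonical-degree = degree-cong (canonical H) H (canonical-adj H)

  canonical-degreeSum : degreeSum (canonical H) ≡ degreeSum H
  canonical-degreeSum = sum-cong-≗ canonical-degree

degreeSum-bound : ∀ {k} b → T (everyGraph k (isYes ∘ λ H → triangleFree? H →-dec degreeSum H ≤? b)) →
                  (H : Graph k) → TriangleFree H → degreeSum H ≤ b
degreeSum-bound b ok H tf =
  subst (_≤ b) (canonical-degreeSum H) (byExhaustion _ ok H (canonical-triangleFree H tf))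

triangleFree⇒degreeSum≤10 : ∀ {m} → m ≤ 4 → (H : Graph m) → TriangleFree H → degreeSum H ≤ 10
triangleFree⇒degreeSum≤10 z≤n                         = degreeSum-bound 10 _
triangleFree⇒degreeSum≤10 (s≤s z≤n)                   = degreeSum-bound 10 _
triangleFree⇒degreeSum≤10 (s≤s (s≤s z≤n))             = degreeSum-bound 10 _
triangleFree⇒degreeSum≤10 (s≤s (s≤s (s≤s z≤n)))       = degreeSum-bound 10 _
triangleFree⇒degreeSum≤10 (s≤s (s≤s (s≤s (s≤s z≤n)))) = degreeSum-bound 10 _

triangleFree⇒degreeSum≤12 : ∀ {m} → m ≤ 5 → (H : Graph m) → TriangleFree H → degreeSum H ≤ 12
triangleFree⇒degreeSum≤12 m≤5 H tf with m≤n⇒m<n∨m≡n m≤5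
... | inj₁ (s≤s m≤4) = ≤-trans (triangleFree⇒degreeSum≤10 m≤4 H tf) (m≤m+n 10 2)
... | inj₂ refl      = degreeSum-bound 12 _ H tf

-- A triangle-free graph on five vertices with at least six edges is K₂,₃;
-- these are the features of K₂,₃ that the discharging argument uses.
record K₂₃Like {m} (H : Graph m) : Set where
  field
    edge-meets-degree3 : ∀ s t → adj H s t ≡ true → 3 ≤ degree H s ⊎ 3 ≤ degree H t
    neighbour          : ∀ s → ∃[ t ] adj H s t ≡ true
    three-of-degree≤2  : 3 ≤ count (λ s → degree H s ≤ᵇ 2)

K₂₃Like? : ∀ {m} (H : Graph m) → Dec (K₂₃Like H)
K₂₃Like? H = map′
  (λ (edges , neighbours , low) → record
    { edge-meets-degree3 = edges ; neighbour = neighbours ; three-of-degree≤2 = low })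
  (λ K → K₂₃Like.edge-meets-degree3 K , K₂₃Like.neighbour K , K₂₃Like.three-of-degree≤2 K)
  (   (all? λ s → all? λ t → (adj H s t ≟ᵇ true) →-dec (3 ≤? degree H s ⊎-dec 3 ≤? degree H t))
  ×-dec (all? λ s → any? λ t → adj H s t ≟ᵇ true)
  ×-dec 3 ≤? count (λ s → degree H s ≤ᵇ 2))

K₂₃Like-canonical : ∀ {k} (H : Graph k) → K₂₃Like (canonical H) → K₂₃Like H
K₂₃Like-canonical H K = record
  { edge-meets-degree3 = λ s t st →
      Sum.map (subst (3 ≤_) (canonical-degree H s)) (subst (3 ≤_) (canonical-degree H t))
        (edge-meets-degree3 s t (trans (canonical-adj H s t) st))
  ; neighbour          = λ s → let (t , st) = neighbour s in t , trans (sym (canonical-adj H s t)) st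
  ; three-of-degree≤2  = subst (3 ≤_)
      (cong List.sum (map-cong (λ s → cong (λ d → ⟦ d ≤ᵇ 2 ⟧) (canonical-degree H s)) (allFin _)))
      three-of-degree≤2
  }
  where open K₂₃Like K

dense⇒K₂₃Like : ∀ {m} → m ≤ 5 → (H : Graph m) → TriangleFree H → 11 ≤ degreeSum H → K₂₃Like H
dense⇒K₂₃Like m≤5 H tf dense with m≤n⇒m<n∨m≡n m≤5
... | inj₁ (s≤s m≤4) = ⊥-elim (<⇒≱ dense (triangleFree⇒degreeSum≤10 m≤4 H tf))
... | inj₂ refl      = K₂₃Like-canonical H
  (byExhaustion (λ H → triangleFree? H →-dec 11 ≤? degreeSum H →-dec K₂₃Like? H) _ H
    (canonical-triangleFree H tf) (subst (11 ≤_) (sym (canonical-degreeSum H)) dense))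

-- Codegrees, K₄-freeness and neighbourhoods

codegree : ∀ {n} → Graph n → Fin n → Fin n → ℕ
codegree {n} G x y = ∑[ k < n ] ⟦ adj G x k ∧ adj G y k ⟧

codegree-sym : ∀ {n} (G : Graph n) x y → codegree G x y ≡ codegree G y x
codegree-sym G x y = sum-cong-≗ (λ k → cong ⟦_⟧ (∧-comm (adj G x k) (adj G y k)))

codegreeSum : ∀ {n} → Graph n → Fin n → ℕ
codegreeSum {n} G x = ∑[ y < n ] (if adj G x y then codegree G x y else 0)

K₄Free : ∀ {n} → Graph n → Set
K₄Free {n} G = ∀ (a b c d : Fin n) → (adj G a b ∧ adj G a c ∧ adj G a d ∧ triangle G b c d) ≡ false

K₄Free? : ∀ {n} (G : Graph n) → Dec (K₄Free G)
K₄Free? G = all? λ a → all? λ b → all? λ c → all? λ d →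
  (adj G a b ∧ adj G a c ∧ adj G a d ∧ triangle G b c d) ≟ᵇ false

cliqueNumber≤3⇒K₄Free : ∀ {n} (G : Graph n) → CliqueNumberAtMost G 3 → K₄Free G
cliqueNumber≤3⇒K₄Free G ω≤3 a b c d = ¬T⇒≡false λ K₄ →
  let ab , K₄ = T-∧⁻ K₄ ; ac , K₄ = T-∧⁻ K₄ ; ad , K₄ = T-∧⁻ K₄
      bc , K₄ = T-∧⁻ K₄ ; bd , cd = T-∧⁻ K₄
  in <-irrefl refl (ω≤3 (a ∷ b ∷ c ∷ d ∷ [])
       ( (≢ ab ∷ ≢ ac ∷ ≢ ad ∷ []) ∷ (≢ bc ∷ ≢ bd ∷ []) ∷ (≢ cd ∷ []) ∷ [] ∷ []
       , (≡t ab ∷ ≡t ac ∷ ≡t ad ∷ []) ∷ (≡t bc ∷ ≡t bd ∷ []) ∷ (≡t cd ∷ []) ∷ [] ∷ []))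
  where
  T-∧⁻ : ∀ {x y} → T (x ∧ y) → T x × T y
  T-∧⁻ = Equivalence.to T-∧
  ¬T⇒≡false : ∀ {x} → ¬ T x → x ≡ false
  ¬T⇒≡false {true}  ¬t = ⊥-elim (¬t _)
  ¬T⇒≡false {false} _  = refl
  ≡t : ∀ {x y} → T (adj G x y) → adj G x y ≡ true
  ≡t = Equivalence.to T-≡
  ≢ : ∀ {x y} → T (adj G x y) → ¬ x ≡ y
  ≢ {x} t refl = subst T (irrefl G x) t

K₄Free⇒cliqueNumber≤3 : ∀ {n} (G : Graph n) → K₄Free G → CliqueNumberAtMost G 3
K₄Free⇒cliqueNumber≤3 G k4 []                    _ = z≤n
K₄Free⇒cliqueNumber≤3 G k4 (_ ∷ [])              _ = s≤s z≤n
K₄Free⇒cliqueNumber≤3 G k4 (_ ∷ _ ∷ [])          _ = s≤s (s≤s z≤n)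
K₄Free⇒cliqueNumber≤3 G k4 (_ ∷ _ ∷ _ ∷ [])      _ = s≤s (s≤s (s≤s z≤n))
K₄Free⇒cliqueNumber≤3 G k4 (a ∷ b ∷ c ∷ d ∷ _)
  (_ , (ab ∷ ac ∷ ad ∷ _) ∷ (bc ∷ bd ∷ _) ∷ (cd ∷ _) ∷ _) = ⊥-elim (true≢false (trans (sym K₄) (k4 a b c d)))
  where
  K₄ : (adj G a b ∧ adj G a c ∧ adj G a d ∧ triangle G b c d) ≡ true
  K₄ rewrite ab | ac | ad | bc | bd | cd = refl
  true≢false : ¬ true ≡ false
  true≢false ()

K₄Free⇒no-common-neighbour : ∀ {n} (G : Graph n) → K₄Free G → ∀ {a b c} →
  adj G a b ≡ true → adj G a c ≡ true → adj G b c ≡ true → ∀ d → (adj G a d ∧ adj G b d ∧ adj G c d) ≡ false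
K₄Free⇒no-common-neighbour G k4 {a} {b} {c} ab ac bc d with k4 a b c d
... | K₄ rewrite ab | ac | bc = K₄

codegree+codegree≤degree : ∀ {n} (G : Graph n) → K₄Free G → ∀ {a x y} →
  adj G a x ≡ true → adj G a y ≡ true → adj G x y ≡ true → codegree G a x + codegree G a y ≤ degree G a
codegree+codegree≤degree {n} G k4 {a} {x} {y} ax ay xy = begin
  codegree G a x + codegree G a y                                        ≡⟨ ∑-distrib-+ {n} _ _ ⟨
  ∑[ k < n ] (⟦ adj G a k ∧ adj G x k ⟧ + ⟦ adj G a k ∧ adj G y k ⟧)
    ≤⟨ ∑-mono-≤ (λ k → ⟦p∧q⟧+⟦p∧r⟧≤⟦p⟧ _ _ _ (K₄Free⇒no-common-neighbour G k4 ax ay xy k)) ⟩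
  ∑[ k < n ] ⟦ adj G a k ⟧                                                ≡⟨ degree≡∑ G a ⟨
  degree G a                                                             ∎
  where open ≤-Reasoning

record Neighbourhood {n} (G : Graph n) (x : Fin n) : Set where
  field
    size       : ℕ
    member     : Fin size → Fin n
    member-adj : ∀ s → adj G x (member s) ≡ true
    index      : ∀ {v} → adj G x v ≡ true → ∃[ s ] member s ≡ v
    ∑-members  : ∀ (g : Fin n → ℕ) → ∑[ v < n ] (if adj G x v then g v else 0) ≡ ∑[ s < size ] g (member s)

  induced : Graph size
  induced = record
    { adj    = λ s t → adj G (member s) (member t)
    ; sym    = λ s t → Graph.sym G (member s) (member t)
    ; irrefl = λ s → irrefl G (member s)
    }

sum-map-filterᵇ : ∀ {A : Set} (p : A → Bool) (g : A → ℕ) xs →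
                  List.sum (map (λ x → if p x then g x else 0) xs) ≡ List.sum (map g (filterᵇ p xs))
sum-map-filterᵇ p g []       = refl
sum-map-filterᵇ p g (x ∷ xs) with p x
... | true  = cong (g x +_) (sum-map-filterᵇ p g xs)
... | false = sum-map-filterᵇ p g xs

sum-map≡∑-lookup : ∀ {A : Set} (g : A → ℕ) xs → List.sum (map g xs) ≡ ∑[ s < length xs ] g (lookup xs s)
sum-map≡∑-lookup g []       = refl
sum-map≡∑-lookup g (x ∷ xs) = cong (g x +_) (sum-map≡∑-lookup g xs)

neighbourhood : ∀ {n} (G : Graph n) (x : Fin n) → Neighbourhood G x
neighbourhood {n} G x = record
  { size       = length L
  ; member     = lookup L
  ; member-adj = λ s → Equivalence.to T-≡ (proj₂ (∈-filter⁻ (T? ∘ adj G x) {xs = allFin n} (∈-lookup s)))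
  ; index      = λ x~v → let v∈L = ∈-filter⁺ (T? ∘ adj G x) (∈-allFin _) (Equivalence.from T-≡ x~v)
                         in Any.index v∈L , sym (lookup-index v∈L)
  ; ∑-members  = λ g → trans (sym (sumFin≡∑ (λ v → if adj G x v then g v else 0)))
                             (trans (sum-map-filterᵇ (adj G x) g (allFin n)) (sum-map≡∑-lookup g L))
  }
  where
  L : List (Fin n)
  L = filterᵇ (adj G x) (allFin n)

module _ {n} {G : Graph n} {x : Fin n} (N : Neighbourhood G x) where
  open Neighbourhood N
  open ≡-Reasoning

  size≡degree : size ≡ degree G x
  size≡degree = sym (begin
    degree G x               ≡⟨ degree≡∑ G x ⟩
    ∑[ v < n ] ⟦ adj G x v ⟧ ≡⟨ ∑-members (λ _ → 1) ⟩
    ∑[ s < size ] 1          ≡⟨ ∑-const size 1 ⟩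
    size * 1                 ≡⟨ *-identityʳ size ⟩
    size                     ∎)

  degree-induced : ∀ s → degree induced s ≡ codegree G x (member s)
  degree-induced s = begin
    degree induced s                                              ≡⟨ degree≡∑ induced s ⟩
    ∑[ t < size ] ⟦ adj G (member s) (member t) ⟧                  ≡⟨ ∑-members (⟦_⟧ ∘ adj G (member s)) ⟨
    ∑[ v < n ] (if adj G x v then ⟦ adj G (member s) v ⟧ else 0) ≡⟨ sum-cong-≗ (λ v → ⟦∧⟧ (adj G x v) _) ⟨
    codegree G x (member s)                                       ∎

  degreeSum-induced : degreeSum induced ≡ codegreeSum G x
  degreeSum-induced = trans (sum-cong-≗ degree-induced) (sym (∑-members (codegree G x)))

  induced-triangleFree : K₄Free G → TriangleFree induced
  induced-triangleFree k4 s t r with k4 x (member s) (member t) (member r)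
  ... | K₄ rewrite member-adj s | member-adj t | member-adj r = K₄

-- Counting triangles

ascending : ℕ → ℕ → ℕ → Bool
ascending a b c = (a <ᵇ b) ∧ (b <ᵇ c)

<ᵇ-trans : ∀ {a b c} → (a <ᵇ b) ≡ true → (b <ᵇ c) ≡ true → (a <ᵇ c) ≡ true
<ᵇ-trans {a} {b} {c} ab bc = Equivalence.to T-≡
  (<⇒<ᵇ (<-trans (<ᵇ⇒< a b (Equivalence.from T-≡ ab)) (<ᵇ⇒< b c (Equivalence.from T-≡ bc))))

⟦<ᵇ⟧+⟦>ᵇ⟧≤1 : ∀ a b → ⟦ a <ᵇ b ⟧ + ⟦ b <ᵇ a ⟧ ≤ 1
⟦<ᵇ⟧+⟦>ᵇ⟧≤1 zero    zero    = z≤n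
⟦<ᵇ⟧+⟦>ᵇ⟧≤1 zero    (suc b) = ≤-refl
⟦<ᵇ⟧+⟦>ᵇ⟧≤1 (suc a) zero    = ≤-refl
⟦<ᵇ⟧+⟦>ᵇ⟧≤1 (suc a) (suc b) = ⟦<ᵇ⟧+⟦>ᵇ⟧≤1 a b

⟦ascending⟧ : ∀ a b c → ⟦ (a <ᵇ b) ∧ (b <ᵇ c) ⟧ ≡ ⟦ a <ᵇ b ⟧ * ⟦ b <ᵇ c ⟧ * ⟦ a <ᵇ c ⟧
⟦ascending⟧ a b c with a <ᵇ b in ab | b <ᵇ c in bc
... | true  | true  = sym (trans (+-identityʳ _) (cong ⟦_⟧ (<ᵇ-trans {a} {b} {c} ab bc)))
... | true  | false = refl
... | false | _     = refl

-- The six ascending orders are six of the eight terms of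
-- (⟦a<b⟧ + ⟦b<a⟧)(⟦b<c⟧ + ⟦c<b⟧)(⟦a<c⟧ + ⟦c<a⟧), a product of factors at most 1.
atMostOneAscending : ∀ a b c →
  ⟦ ascending a b c ⟧ + ⟦ ascending a c b ⟧ + ⟦ ascending b a c ⟧ +
  ⟦ ascending b c a ⟧ + ⟦ ascending c a b ⟧ + ⟦ ascending c b a ⟧ ≤ 1
atMostOneAscending a b c
  rewrite ⟦ascending⟧ a b c | ⟦ascending⟧ a c b | ⟦ascending⟧ b a c
        | ⟦ascending⟧ b c a | ⟦ascending⟧ c a b | ⟦ascending⟧ c b a = begin
  A * B * C + C * B′ * A + A′ * C * B + B * C′ * A′ + C′ * A * B′ + B′ * A′ * C′
    ≤⟨ m≤m+n _ (A * B * C′ + A′ * B′ * C) ⟩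
  A * B * C + C * B′ * A + A′ * C * B + B * C′ * A′ + C′ * A * B′ + B′ * A′ * C′ + (A * B * C′ + A′ * B′ * C)
    ≡⟨ expand A A′ B B′ C C′ ⟩
  (A + A′) * (B + B′) * (C + C′)
    ≤⟨ *-mono-≤ (*-mono-≤ (⟦<ᵇ⟧+⟦>ᵇ⟧≤1 a b) (⟦<ᵇ⟧+⟦>ᵇ⟧≤1 b c)) (⟦<ᵇ⟧+⟦>ᵇ⟧≤1 a c) ⟩
  1 ∎
  where
  open ≤-Reasoning
  A A′ B B′ C C′ : ℕ
  A = ⟦ a <ᵇ b ⟧ ; A′ = ⟦ b <ᵇ a ⟧
  B = ⟦ b <ᵇ c ⟧ ; B′ = ⟦ c <ᵇ b ⟧
  C = ⟦ a <ᵇ c ⟧ ; C′ = ⟦ c <ᵇ a ⟧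
  open +-*-Solver
  expand : ∀ A A′ B B′ C C′ →
    A * B * C + C * B′ * A + A′ * C * B + B * C′ * A′ + C′ * A * B′ + B′ * A′ * C′ + (A * B * C′ + A′ * B′ * C)
      ≡ (A + A′) * (B + B′) * (C + C′)
  expand = solve 6 (λ A A′ B B′ C C′ →
    A :* B :* C :+ C :* B′ :* A :+ A′ :* C :* B :+ B :* C′ :* A′ :+ C′ :* A :* B′ :+ B′ :* A′ :* C′
      :+ (A :* B :* C′ :+ A′ :* B′ :* C)
      := (A :+ A′) :* (B :+ B′) :* (C :+ C′)) refl

∑³ : ∀ {n} → (Fin n → Fin n → Fin n → ℕ) → ℕ
∑³ {n} F = ∑[ i < n ] ∑[ j < n ] ∑[ k < n ] F i j k

module _ {n : ℕ} where

  ∑³-swap₂₃ : (F : Fin n → Fin n → Fin n → ℕ) → ∑³ (λ i j k → F i k j) ≡ ∑³ F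
  ∑³-swap₂₃ F = sum-cong-≗ (λ i → ∑-comm (λ j k → F i k j))

  ∑³-swap₁₂ : (F : Fin n → Fin n → Fin n → ℕ) → ∑³ (λ i j k → F j i k) ≡ ∑³ F
  ∑³-swap₁₂ F = ∑-comm (λ i j → ∑[ k < n ] F j i k)

  ∑³-distrib-+ : (F H : Fin n → Fin n → Fin n → ℕ) → ∑³ (λ i j k → F i j k + H i j k) ≡ ∑³ F + ∑³ H
  ∑³-distrib-+ F H = trans
    (sum-cong-≗ λ i → trans (sum-cong-≗ λ j → ∑-distrib-+ (F i j) (H i j))
                            (∑-distrib-+ (λ j → ∑[ k < n ] F i j k) (λ j → ∑[ k < n ] H i j k)))
    (∑-distrib-+ (λ i → ∑[ j < n ] ∑[ k < n ] F i j k) (λ i → ∑[ j < n ] ∑[ k < n ] H i j k))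

  ∑³-mono-≤ : {F H : Fin n → Fin n → Fin n → ℕ} → (∀ i j k → F i j k ≤ H i j k) → ∑³ F ≤ ∑³ H
  ∑³-mono-≤ F≤H = ∑-mono-≤ λ i → ∑-mono-≤ λ j → ∑-mono-≤ (F≤H i j)

  ∑³-symmetrize : (F : Fin n → Fin n → Fin n → ℕ) →
    ∑³ (λ i j k → F i j k + F i k j + F j i k + F j k i + F k i j + F k j i) ≡ 6 * ∑³ F
  ∑³-symmetrize F
    rewrite ∑³-distrib-+ (λ i j k → F i j k + F i k j + F j i k + F j k i + F k i j) (λ i j k → F k j i)
          | ∑³-distrib-+ (λ i j k → F i j k + F i k j + F j i k + F j k i) (λ i j k → F k i j)
          | ∑³-distrib-+ (λ i j k → F i j k + F i k j + F j i k) (λ i j k → F j k i)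
          | ∑³-distrib-+ (λ i j k → F i j k + F i k j) (λ i j k → F j i k)
          | ∑³-distrib-+ F (λ i j k → F i k j)
          | ∑³-swap₂₃ F | ∑³-swap₁₂ F
          | ∑³-swap₁₂ (λ i j k → F i k j) | ∑³-swap₂₃ F
          | ∑³-swap₂₃ (λ i j k → F j i k) | ∑³-swap₁₂ F
          | ∑³-swap₂₃ (λ i j k → F j k i) | ∑³-swap₁₂ (λ i j k → F i k j) | ∑³-swap₂₃ F
    = sym (six-times (∑³ F))
    where
    open +-*-Solver
    six-times : ∀ x → 6 * x ≡ x + x + x + x + x + x
    six-times = solve 1 (λ x → con 6 :* x := x :+ x :+ x :+ x :+ x :+ x) refl

module _ {n : ℕ} (G : Graph n) where

  triangle-swap₁₂ : ∀ a b c → triangle G a b c ≡ triangle G b a c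
  triangle-swap₁₂ a b c rewrite Graph.sym G b a = cong (adj G a b ∧_) (∧-comm (adj G a c) (adj G b c))

  triangle-swap₂₃ : ∀ a b c → triangle G a b c ≡ triangle G a c b
  triangle-swap₂₃ a b c rewrite Graph.sym G c b = begin
    x ∧ y ∧ z   ≡⟨ ∧-assoc x y z ⟨
    (x ∧ y) ∧ z ≡⟨ cong (_∧ z) (∧-comm x y) ⟩
    (y ∧ x) ∧ z ≡⟨ ∧-assoc y x z ⟩
    y ∧ x ∧ z   ∎
    where
    open ≡-Reasoning
    x y z : Bool
    x = adj G a b ; y = adj G a c ; z = adj G b c

  ascendingTriangle : Fin n → Fin n → Fin n → ℕ
  ascendingTriangle i j k = ⟦ ascending (toℕ i) (toℕ j) (toℕ k) ⟧ * ⟦ triangle G i j k ⟧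

  k₃≡∑³ : k₃ G ≡ ∑³ ascendingTriangle
  k₃≡∑³ =
    trans (sumFin≡∑ {n} _) (sum-cong-≗ λ i →
    trans (sumFin≡∑ {n} _) (sum-cong-≗ λ j →
    trans (sumFin≡∑ {n} _) (sum-cong-≗ λ k →
    summand (toℕ i <ᵇ toℕ j) (toℕ j <ᵇ toℕ k) (adj G i j) (adj G j k) (adj G i k))))
    where
    summand : ∀ p q x y z → ⟦ p ∧ q ∧ x ∧ y ∧ z ⟧ ≡ ⟦ p ∧ q ⟧ * ⟦ x ∧ z ∧ y ⟧
    summand p q x y z = trans (cong ⟦_⟧ (sym (∧-assoc p q _)))
      (trans (⟦∧⟧≡* (p ∧ q) _) (cong (λ t → ⟦ p ∧ q ⟧ * ⟦ x ∧ t ⟧) (∧-comm y z)))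

  ascendingTriangles≤triangle : ∀ i j k →
    ascendingTriangle i j k + ascendingTriangle i k j + ascendingTriangle j i k +
    ascendingTriangle j k i + ascendingTriangle k i j + ascendingTriangle k j i ≤ ⟦ triangle G i j k ⟧
  ascendingTriangles≤triangle i j k
    rewrite sym (triangle-swap₂₃ i j k) | sym (triangle-swap₁₂ i j k)
          | trans (triangle-swap₂₃ j k i) (triangle-swap₁₂ j i k)
          | trans (triangle-swap₁₂ k i j) (triangle-swap₂₃ i k j)
          | trans (triangle-swap₂₃ k j i) (trans (triangle-swap₁₂ k i j) (triangle-swap₂₃ i k j)) = begin
    A₁ * t + A₂ * t + A₃ * t + A₄ * t + A₅ * t + A₆ * t ≡⟨ factor A₁ A₂ A₃ A₄ A₅ A₆ t ⟩
    (A₁ + A₂ + A₃ + A₄ + A₅ + A₆) * t                   ≤⟨ *-mono-≤ (atMostOneAscending (toℕ i) (toℕ j) (toℕ k)) ≤-refl ⟩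
    1 * t                                               ≡⟨ *-identityˡ t ⟩
    t                                                   ∎
    where
    open ≤-Reasoning
    t A₁ A₂ A₃ A₄ A₅ A₆ : ℕ
    t = ⟦ triangle G i j k ⟧
    A₁ = ⟦ ascending (toℕ i) (toℕ j) (toℕ k) ⟧ ; A₂ = ⟦ ascending (toℕ i) (toℕ k) (toℕ j) ⟧
    A₃ = ⟦ ascending (toℕ j) (toℕ i) (toℕ k) ⟧ ; A₄ = ⟦ ascending (toℕ j) (toℕ k) (toℕ i) ⟧
    A₅ = ⟦ ascending (toℕ k) (toℕ i) (toℕ j) ⟧ ; A₆ = ⟦ ascending (toℕ k) (toℕ j) (toℕ i) ⟧
    open +-*-Solver
    factor : ∀ a₁ a₂ a₃ a₄ a₅ a₆ t →
      a₁ * t + a₂ * t + a₃ * t + a₄ * t + a₅ * t + a₆ * t ≡ (a₁ + a₂ + a₃ + a₄ + a₅ + a₆) * t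
    factor = solve 7 (λ a₁ a₂ a₃ a₄ a₅ a₆ t →
      a₁ :* t :+ a₂ :* t :+ a₃ :* t :+ a₄ :* t :+ a₅ :* t :+ a₆ :* t := (a₁ :+ a₂ :+ a₃ :+ a₄ :+ a₅ :+ a₆) :* t) refl

  codegreeSum≡∑triangles : ∀ x → codegreeSum G x ≡ ∑[ y < n ] ∑[ k < n ] ⟦ triangle G x y k ⟧
  codegreeSum≡∑triangles x = sum-cong-≗ λ y → through (adj G x y)
    where
    through : ∀ {y} b → (if b then codegree G x y else 0) ≡ ∑[ k < n ] ⟦ b ∧ adj G x k ∧ adj G y k ⟧
    through true  = refl
    through false = sym (sum-replicate-zero n)

  6k₃≤∑codegreeSum : 6 * k₃ G ≤ ∑[ x < n ] codegreeSum G x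
  6k₃≤∑codegreeSum = begin
    6 * k₃ G                            ≡⟨ cong (6 *_) k₃≡∑³ ⟩
    6 * ∑³ ascendingTriangle            ≡⟨ ∑³-symmetrize ascendingTriangle ⟨
    _                                   ≤⟨ ∑³-mono-≤ ascendingTriangles≤triangle ⟩
    ∑³ (λ i j k → ⟦ triangle G i j k ⟧) ≡⟨ sum-cong-≗ codegreeSum≡∑triangles ⟨
    ∑[ x < n ] codegreeSum G x          ∎
    where open ≤-Reasoning

-- Discharging

discharging : ∀ {n} (weight : Fin n → ℕ) (send : Fin n → Fin n → ℕ) c →
              (∀ x → weight x + ∑[ v < n ] send v x ≤ c + ∑[ v < n ] send x v) →
              ∑[ x < n ] weight x ≤ n * c
discharging {n} weight send c balance = +-cancelʳ-≤ sent (∑[ x < n ] weight x) (n * c) (begin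
  ∑[ x < n ] weight x + sent                           ≡⟨ cong (∑[ x < n ] weight x +_) (∑-comm send) ⟩
  ∑[ x < n ] weight x + ∑[ x < n ] ∑[ v < n ] send v x ≡⟨ ∑-distrib-+ weight (λ x → ∑[ v < n ] send v x) ⟨
  ∑[ x < n ] (weight x + ∑[ v < n ] send v x)          ≤⟨ ∑-mono-≤ balance ⟩
  ∑[ x < n ] (c + ∑[ v < n ] send x v)                 ≡⟨ ∑-distrib-+ (λ _ → c) (λ x → ∑[ v < n ] send x v) ⟩
  ∑[ x < n ] c + sent                                  ≡⟨ cong (_+ sent) (∑-const n c) ⟩
  n * c + sent                                         ∎)
  where
  open ≤-Reasoning
  sent : ℕ
  sent = ∑[ x < n ] ∑[ v < n ] send x v

isFull : ∀ {n} → Graph n → Fin n → Bool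
isFull G x = does (11 ≤? codegreeSum G x)

fullness : ∀ {n} (G : Graph n) x →
  isFull G x ≡ true × 11 ≤ codegreeSum G x ⊎ isFull G x ≡ false × codegreeSum G x ≤ 10
fullness G x = byDecision (11 ≤? codegreeSum G x)
  where
  byDecision : (d : Dec (11 ≤ codegreeSum G x)) →
    does d ≡ true × 11 ≤ codegreeSum G x ⊎ does d ≡ false × codegreeSum G x ≤ 10
  byDecision (yes full)   = inj₁ (refl , full)
  byDecision (no notFull) = inj₂ (refl , ≤-pred (≰⇒> notFull))

charge : ∀ {n} → Graph n → Fin n → Fin n → ℕ
charge G v w = 2 * ⟦ isFull G v ∧ adj G v w ∧ not (isFull G w) ⟧

module Class₅₃ {n} (G : Graph n) (Δ≤5 : MaxDegreeAtMost G 5) (k4 : K₄Free G) where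
  open Neighbourhood

  size≤5 : ∀ x → size (neighbourhood G x) ≤ 5
  size≤5 x = subst (_≤ 5) (sym (size≡degree (neighbourhood G x))) (Δ≤5 x)

  codegreeSum≤12 : ∀ x → codegreeSum G x ≤ 12
  codegreeSum≤12 x = subst (_≤ 12) (degreeSum-induced N)
    (triangleFree⇒degreeSum≤12 (size≤5 x) (induced N) (induced-triangleFree N k4))
    where
    N : Neighbourhood G x
    N = neighbourhood G x

  full⇒K₂₃Like : ∀ x → 11 ≤ codegreeSum G x → K₂₃Like (induced (neighbourhood G x))
  full⇒K₂₃Like x full = dense⇒K₂₃Like (size≤5 x) (induced N) (induced-triangleFree N k4)
    (subst (11 ≤_) (sym (degreeSum-induced N)) full)
    where
    N : Neighbourhood G x
    N = neighbourhood G x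

  full-edge-meets-codegree3 : ∀ {w v a} → 11 ≤ codegreeSum G w →
    adj G w v ≡ true → adj G w a ≡ true → adj G v a ≡ true → 3 ≤ codegree G w v ⊎ 3 ≤ codegree G w a
  full-edge-meets-codegree3 {w} full wv wa va
    with index (neighbourhood G w) wv | index (neighbourhood G w) wa
  ... | s , refl | t , refl =
    Sum.map (subst (3 ≤_) (degree-induced N s)) (subst (3 ≤_) (degree-induced N t))
      (K₂₃Like.edge-meets-degree3 (full⇒K₂₃Like w full) s t va)
    where
    N : Neighbourhood G w
    N = neighbourhood G w

  high-codegree⇒low-codegree : ∀ {a x y} → adj G a x ≡ true → adj G a y ≡ true → adj G x y ≡ true →
                               3 ≤ codegree G a x → codegree G a y ≤ 2
  high-codegree⇒low-codegree {a} ax ay xy high = +-cancelˡ-≤ 3 _ 2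
    (≤-trans (+-monoˡ-≤ _ high) (≤-trans (codegree+codegree≤degree G k4 ax ay xy) (Δ≤5 a)))

  lowNeighbour-notFull : ∀ {x} → 11 ≤ codegreeSum G x → ∀ s →
    degree (induced (neighbourhood G x)) s ≤ 2 → ¬ 11 ≤ codegreeSum G (member (neighbourhood G x) s)
  lowNeighbour-notFull {x} full s low fullY =
    [ (λ high → <⇒≱ high yx-low) , (λ high → <⇒≱ high ya-low) ]′ (full-edge-meets-codegree3 fullY yx ya xa)
    where
    N : Neighbourhood G x
    N = neighbourhood G x
    K : K₂₃Like (induced N)
    K = full⇒K₂₃Like x full
    t : Fin (size N)
    t = proj₁ (K₂₃Like.neighbour K s)
    y a : Fin n
    y = member N s
    a = member N t
    ya : adj G y a ≡ true
    ya = proj₂ (K₂₃Like.neighbour K s)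
    xa : adj G x a ≡ true
    xa = member-adj N t
    yx : adj G y x ≡ true
    yx = trans (Graph.sym G y x) (member-adj N s)
    t-high : 3 ≤ codegree G a x
    t-high = subst (3 ≤_) (trans (degree-induced N t) (codegree-sym G x a))
      ([ (λ s-high → ⊥-elim (<⇒≱ s-high low)) , (λ high → high) ]′ (K₂₃Like.edge-meets-degree3 K s t ya))
    yx-low : codegree G y x ≤ 2
    yx-low = subst (_≤ 2) (trans (degree-induced N s) (codegree-sym G x y)) low
    ya-low : codegree G y a ≤ 2
    ya-low = subst (_≤ 2) (codegree-sym G a y)
      (high-codegree⇒low-codegree (trans (Graph.sym G a x) xa) (trans (Graph.sym G a y) ya) (member-adj N s) t-high)

  full⇒three-nonfull : ∀ {x} → 11 ≤ codegreeSum G x → 3 ≤ ∑[ y < n ] ⟦ adj G x y ∧ not (isFull G y) ⟧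
  full⇒three-nonfull {x} full = begin
    3                                                          ≤⟨ K₂₃Like.three-of-degree≤2 (full⇒K₂₃Like x full) ⟩
    count (λ s → degree (induced N) s ≤ᵇ 2)                    ≡⟨ sumFin≡∑ (λ s → ⟦ degree (induced N) s ≤ᵇ 2 ⟧) ⟩
    ∑[ s < size N ] ⟦ degree (induced N) s ≤ᵇ 2 ⟧               ≤⟨ ∑-mono-≤ low⇒nonfull ⟩
    ∑[ s < size N ] ⟦ not (isFull G (member N s)) ⟧             ≡⟨ ∑-members N _ ⟨
    ∑[ y < n ] (if adj G x y then ⟦ not (isFull G y) ⟧ else 0) ≡⟨ sum-cong-≗ (λ y → ⟦∧⟧ (adj G x y) _) ⟨
    ∑[ y < n ] ⟦ adj G x y ∧ not (isFull G y) ⟧                 ∎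
    where
    open ≤-Reasoning
    N : Neighbourhood G x
    N = neighbourhood G x
    nonfull : ∀ s → degree (induced N) s ≤ 2 → isFull G (member N s) ≡ false
    nonfull s low = [ (λ (_ , fullY) → ⊥-elim (lowNeighbour-notFull full s low fullY)) , proj₁ ]′
                      (fullness G (member N s))
    low⇒nonfull : ∀ s → ⟦ degree (induced N) s ≤ᵇ 2 ⟧ ≤ ⟦ not (isFull G (member N s)) ⟧
    low⇒nonfull s with degree (induced N) s ≤ᵇ 2 in low
    ... | false = z≤n
    ... | true rewrite nonfull s (≤ᵇ⇒≤ _ 2 (Equivalence.from T-≡ low)) = ≤-refl

  charge-to-full : ∀ {x} → isFull G x ≡ true → ∀ v → charge G v x ≡ 0
  charge-to-full {x} full v = trans (cong (λ b → 2 * ⟦ isFull G v ∧ adj G v x ∧ not b ⟧) full)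
    (cong (λ b → 2 * ⟦ b ⟧) (trans (cong (isFull G v ∧_) (∧-zeroʳ _)) (∧-zeroʳ _)))

  charge-from-full : ∀ {x} → isFull G x ≡ true →
                     ∑[ v < n ] charge G x v ≡ 2 * ∑[ v < n ] ⟦ adj G x v ∧ not (isFull G v) ⟧
  charge-from-full {x} full =
    trans (sum-cong-≗ λ v → cong (λ b → 2 * ⟦ b ∧ adj G x v ∧ not (isFull G v) ⟧) full)
          (sym (*-distribˡ-sum 2 (λ v → ⟦ adj G x v ∧ not (isFull G v) ⟧)))

  charge-received≤10 : ∀ x → ∑[ v < n ] charge G v x ≤ 2 * 5
  charge-received≤10 x = begin
    ∑[ v < n ] charge G v x         ≤⟨ ∑-mono-≤ (λ v → *-monoʳ-≤ 2 (subst (charge-bit v ≤_)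
                                         (cong ⟦_⟧ (Graph.sym G v x)) (⟦x∧y∧z⟧≤⟦y⟧ (isFull G v) _ _))) ⟩
    ∑[ v < n ] (2 * ⟦ adj G x v ⟧)   ≡⟨ *-distribˡ-sum 2 (λ v → ⟦ adj G x v ⟧) ⟨
    2 * ∑[ v < n ] ⟦ adj G x v ⟧     ≡⟨ cong (2 *_) (degree≡∑ G x) ⟨
    2 * degree G x                  ≤⟨ *-monoʳ-≤ 2 (Δ≤5 x) ⟩
    2 * 5                           ∎
    where
    open ≤-Reasoning
    charge-bit : Fin n → ℕ
    charge-bit v = ⟦ isFull G v ∧ adj G v x ∧ not (isFull G x) ⟧

  Balanced : Fin n → Set
  Balanced x = 8 * codegreeSum G x + ∑[ v < n ] charge G v x ≤ 90 + ∑[ v < n ] charge G x v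

  balance : ∀ x → Balanced x
  balance x = [ fullCase , nonfullCase ]′ (fullness G x)
    where
    open ≤-Reasoning
    fullCase : isFull G x ≡ true × 11 ≤ codegreeSum G x → Balanced x
    fullCase (isFull-x , full) = begin
      8 * codegreeSum G x + ∑[ v < n ] charge G v x
        ≡⟨ cong (8 * codegreeSum G x +_) (trans (sum-cong-≗ (charge-to-full isFull-x)) (sum-replicate-zero n)) ⟩
      8 * codegreeSum G x + 0  ≤⟨ +-monoˡ-≤ 0 (*-monoʳ-≤ 8 (codegreeSum≤12 x)) ⟩
      90 + 2 * 3               ≤⟨ +-monoʳ-≤ 90 (*-monoʳ-≤ 2 (full⇒three-nonfull full)) ⟩
      90 + 2 * ∑[ v < n ] ⟦ adj G x v ∧ not (isFull G v) ⟧ ≡⟨ cong (90 +_) (charge-from-full isFull-x) ⟨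
      90 + ∑[ v < n ] charge G x v ∎
    nonfullCase : isFull G x ≡ false × codegreeSum G x ≤ 10 → Balanced x
    nonfullCase (_ , ≤10) =
      ≤-trans (+-mono-≤ (*-monoʳ-≤ 8 ≤10) (charge-received≤10 x)) (m≤m+n 90 _)

k₃-bound : ∀ {n} (G : Graph n) → InClass G 5 3 → 8 * k₃ G ≤ 15 * n
k₃-bound {n} G (Δ≤5 , ω≤3) = *-cancelˡ-≤ 6 (begin
  6 * (8 * k₃ G)                    ≡⟨ trans (sym (*-assoc 6 8 (k₃ G))) (*-assoc 8 6 (k₃ G)) ⟩
  8 * (6 * k₃ G)                    ≤⟨ *-monoʳ-≤ 8 (6k₃≤∑codegreeSum G) ⟩
  8 * ∑[ x < n ] codegreeSum G x    ≡⟨ *-distribˡ-sum 8 (codegreeSum G) ⟩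
  ∑[ x < n ] (8 * codegreeSum G x)  ≤⟨ discharging _ (charge G) 90 balance ⟩
  n * 90                            ≡⟨ trans (*-comm n 90) (*-assoc 6 15 n) ⟩
  6 * (15 * n)                      ∎)
  where
  open ≤-Reasoning
  open Class₅₃ G Δ≤5 (cliqueNumber≤3⇒K₄Free G ω≤3)

theorem6p5 : ((n : ℕ) (G : Graph n) → InClass G 5 3 → 8 * k₃ G ≤ 15 * n)
             × InClass BT2 5 3
             × 8 * k₃ BT2 ≡ 15 * 8
theorem6p5 =
  (λ n → k₃-bound)
  , ( toWitness {a? = all? λ i → degree BT2 i ≤? 5} _
    , K₄Free⇒cliqueNumber≤3 BT2 (toWitness {a? = K₄Free? BT2} _) )
  , refl
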